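{- Let $f=C_1\wedge\dots\wedge C_k$ be a CNF formula over variables $x_1,\dots,x_n$, each clause $C_j$ being a disjunction of literals from $L=\{x_1,\neg x_1,\dots,x_n,\neg x_n\}$. Define $M=\{C_1,\dots,C_k\}\cup L$ (the $C_j$ treated as new attribute symbols). Define the positive context $\mathbb{K}_+=(G_+,M,\mathcal{I}_+)$ with $G_+=\{g_l\mid l\in L\}\cup\{g_{C_1},\dots,g_{C_k}\}$ where: for $l\in L$, $g_l\,\mathcal{I}_+\,C_j$ iff the literal $l$ does not occur in $C_j$, and $g_l\,\mathcal{I}_+\,l'$ for $l'\in L$ iff $l'\neq l$; and the intent of $g_{C_j}$ is exactly $\{C_j\}$. Define the negative context $\mathbb{K}_-=(G_-,M,\mathcal{I}_-)$ with $G_-=\{h_1,\dots,h_n\}$, where the intent of $h_i$ is $L\setminus\{x_i,\neg x_i\}$. Let $\mathcal{H}=\{\{C_1\},\dots,\{C_k\}\}$. Then there exists a minimal hypothesis $H$ of $\mathbb{K}_\pm$ with $H\notin\mathcal{H}$ if and only if $f$ is satisfiable.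
   Context: For a formal context $(G,M,I)$ with $I\subseteq G\times M$, derivation operators are $A'=\{m\in M\mid gIm\ \forall g\in A\}$ for $A\subseteq G$ and $B'=\{g\in G\mid gIm\ \forall m\in B\}$ for $B\subseteq M$; $B\subseteq M$ is an intent if $B''=B$; the intent of an object $g$ is $\{g\}'$. For positive context $\mathbb{K}_+=(G_+,M,\mathcal{I}_+)$ and negative context $\mathbb{K}_-=(G_-,M,\mathcal{I}_-)$ (derivation operators $(\cdot)^+$, $(\cdot)^-$), a (positive) hypothesis of $\mathbb{K}_\pm$ is a set $H\subseteq M$ that is an intent of $\mathbb{K}_+$ and is not a subset of the intent $g^-$ of any $g\in G_-$. If hypotheses exist, a minimal hypothesis is a hypothesis with no proper subset that is a hypothesis; if none exist, the set of minimal hypotheses is by convention $\{M\}$. -}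

module Defs where

open import Data.Nat using (ℕ)
open import Data.Fin using (Fin)
open import Data.Bool using (Bool; true; false)
open import Data.List using (List)
open import Data.List.Membership.Propositional using (_∈_)
open import Data.Product using (_×_; Σ; ∃; proj₁; proj₂)
open import Data.Sum using (_⊎_)
open import Data.Empty using (⊥)
open import Relation.Nullary using (¬_)
open import Relation.Binary.PropositionalEquality using (_≡_)
open import Function.Bundles using (_⇔_)

Subset : Set → Set
Subset M = M → Bool

_∈ₛ_ : {M : Set} → M → Subset M → Set
m ∈ₛ B = B m ≡ true

_⊆ₛ_ : {M : Set} → Subset M → Subset M → Set
A ⊆ₛ B = ∀ m → m ∈ₛ A → m ∈ₛ B

_⊂ₛ_ : {M : Set} → Subset M → Subset M → Set
A ⊂ₛ B = A ⊆ₛ B × ¬ (B ⊆ₛ A)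

module Context {G M : Set} (I : G → M → Set) where

  extent : Subset M → G → Set
  extent B g = ∀ m → m ∈ₛ B → I g m

  intentOf : (G → Set) → M → Set
  intentOf A m = ∀ g → A g → I g m

  IsIntent : Subset M → Set
  IsIntent B = ∀ m → (m ∈ₛ B) ⇔ intentOf (extent B) m

module Hypotheses {G₊ G₋ M : Set} (I₊ : G₊ → M → Set) (I₋ : G₋ → M → Set) where

  open Context I₊ using (IsIntent)

  IsHyp : Subset M → Set
  IsHyp H = IsIntent H × (∀ (g : G₋) → ¬ (∀ m → m ∈ₛ H → I₋ g m))

  -- H is a minimal hypothesis; by convention the set of minimal
  -- hypotheses is {M} when there are no hypotheses at all.
  IsMinHyp : Subset M → Set
  IsMinHyp H =
      (IsHyp H × (∀ H′ → IsHyp H′ → ¬ (H′ ⊂ₛ H)))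
    ⊎ ((∀ H′ → ¬ IsHyp H′) × (∀ m → m ∈ₛ H))

-- literal (i , true) is x_i, (i , false) is ¬x_i
Lit : ℕ → Set
Lit n = Fin n × Bool

CNF : ℕ → ℕ → Set
CNF n k = Fin k → List (Lit n)

Satisfiable : {n k : ℕ} → CNF n k → Set
Satisfiable {n} {k} C =
  Σ (Fin n → Bool) λ σ → ∀ (j : Fin k) →
    ∃ λ (l : Lit n) → (l ∈ C j) × (σ (proj₁ l) ≡ proj₂ l)

data Attr (n k : ℕ) : Set where
  cl  : Fin k → Attr n k
  lit : Lit n → Attr n k

data Obj₊ (n k : ℕ) : Set where
  gl : Lit n → Obj₊ n k
  gC : Fin k → Obj₊ n k

module Reduction {n k : ℕ} (C : CNF n k) where

  I₊ : Obj₊ n k → Attr n k → Set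
  I₊ (gl l) (cl j)   = ¬ (l ∈ C j)
  I₊ (gl l) (lit l′) = ¬ (l′ ≡ l)
  I₊ (gC j) (cl j′)  = j′ ≡ j
  I₊ (gC j) (lit _)  = ⊥

  I₋ : Fin n → Attr n k → Set
  I₋ i (cl _)   = ⊥
  I₋ i (lit l)  = ¬ (proj₁ l ≡ i)

  open Hypotheses I₊ I₋ public

  InCalH : Subset (Attr n k) → Set
  InCalH H = Σ (Fin k) λ j → ∀ m → (m ∈ₛ H) ⇔ (m ≡ cl j)

-- Every {C_j} is a hypothesis (it is the intent of g_{C_j}), so a minimal
-- hypothesis H outside ℋ contains no clause attribute. A clause-free
-- hypothesis must escape each h_i, i.e. contain x_i or ¬x_i; reading those
-- literals as the false ones gives an assignment σ, and a clause that σ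
-- falsifies would lie in H'' = H. Conversely, for a satisfying σ the literals
-- falsified by σ form an intent (the objects g_l for the true literals l lie
-- in its extent and exclude every other attribute), and this hypothesis is
-- minimal because it holds exactly one literal per variable.
module Submission where

open import Defs
open import Data.Nat using (ℕ; _≤_)
open import Data.Fin using (Fin; fromℕ<) renaming (_≟_ to _≟ᶠ_)
open import Data.Bool using (Bool; true; false; not) renaming (_≟_ to _≟ᵇ_)
open import Data.Bool.Properties using (¬-not; not-¬; not-involutive)
open import Data.Product using (Σ; _×_; _,_; proj₁; proj₂)
open import Data.Sum using (inj₁; inj₂)
open import Data.Empty using (⊥; ⊥-elim)
open import Data.List.Relation.Unary.Any using (Any; any?)
open import Data.List.Membership.Propositional using (_∈_; find; lose)
open import Level using (0ℓ)
open import Relation.Unary using (Pred; Decidable)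
open import Relation.Nullary using (¬_; yes; no; does)
open import Relation.Binary.PropositionalEquality
  using (_≡_; _≢_; refl; sym; trans; cong; subst)
open import Function.Base using (_∘_)
open import Function.Bundles using (_⇔_; mk⇔; Equivalence)

subsetOf : {M : Set} {P : Pred M 0ℓ} → Decidable P → Subset M
subsetOf P? m = does (P? m)

∈-subsetOf : {M : Set} {P : Pred M 0ℓ} (P? : Decidable P) {m : M} →
             m ∈ₛ subsetOf P? ⇔ P m
∈-subsetOf P? {m} with P? m
... | yes p = mk⇔ (λ _ → p) (λ _ → refl)
... | no ¬p = mk⇔ (λ ()) (λ p → ⊥-elim (¬p p))

module _ {G M : Set} (I : G → M → Set) where
  open Context I

  closed⇒isIntent : {B : Subset M} →
                    (∀ m → intentOf (extent B) m → m ∈ₛ B) → IsIntent B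
  closed⇒isIntent closed m = mk⇔ (λ m∈B g g∈B′ → g∈B′ m m∈B) (closed m)

  objectIntent-isIntent : (g : G) (Ig? : Decidable (I g)) →
                          IsIntent (subsetOf Ig?)
  objectIntent-isIntent g Ig? = closed⇒isIntent λ m m∈B″ →
    Equivalence.from (∈-subsetOf Ig?) (m∈B″ g λ _ → Equivalence.to (∈-subsetOf Ig?))

module ReductionProperties {n k : ℕ} (C : CNF n k) where
  open Reduction C
  open Context I₊ using (extent; intentOf)

  Satisfies : (Fin n → Bool) → Set
  Satisfies σ = ∀ j → Σ (Lit n) λ l → (l ∈ C j) × (σ (proj₁ l) ≡ proj₂ l)

  ClauseFree : Subset (Attr n k) → Set
  ClauseFree H = ∀ j → ¬ cl j ∈ₛ H

  clauseFree⇒∉ℋ : ∀ {H} → ClauseFree H → ¬ InCalH H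
  clauseFree⇒∉ℋ free (j , H≐Cⱼ) = free j (Equivalence.from (H≐Cⱼ (cl j)) refl)

  ⊆-clauseFree : ∀ {H H′} → H′ ⊆ₛ H → ClauseFree H → ClauseFree H′
  ⊆-clauseFree H′⊆H free j m∈ = free j (H′⊆H (cl j) m∈)

  clauseFreeHyp-coversVariable : ∀ {H} → IsHyp H → ClauseFree H →
                                 ∀ i → Σ Bool λ b → lit (i , b) ∈ₛ H
  clauseFreeHyp-coversVariable {H} (_ , escapes) free i
    with H (lit (i , true)) in xᵢ∈ | H (lit (i , false)) in ¬xᵢ∈
  ... | true  | _     = true , xᵢ∈
  ... | false | true  = false , ¬xᵢ∈
  ... | false | false = ⊥-elim (escapes i H⊆hᵢ)
    where
    H⊆hᵢ : ∀ m → m ∈ₛ H → I₋ i m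
    H⊆hᵢ (cl j)              m∈ = free j m∈
    H⊆hᵢ (lit (.i , true))  m∈ refl with () ← trans (sym xᵢ∈) m∈
    H⊆hᵢ (lit (.i , false)) m∈ refl with () ← trans (sym ¬xᵢ∈) m∈

  gC-intent? : ∀ j → Decidable (I₊ (gC j))
  gC-intent? j (cl j′) = j′ ≟ᶠ j
  gC-intent? j (lit _) = no λ ()

  clauseSingleton : Fin k → Subset (Attr n k)
  clauseSingleton j = subsetOf (gC-intent? j)

  ∈-clauseSingleton : ∀ j m → m ∈ₛ clauseSingleton j ⇔ m ≡ cl j
  ∈-clauseSingleton j m = mk⇔ (to m ∘ Equivalence.to (∈-subsetOf (gC-intent? j)))
                              λ { refl → Equivalence.from (∈-subsetOf (gC-intent? j)) refl }
    where
    to : ∀ m → I₊ (gC j) m → m ≡ cl j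
    to (cl _) refl = refl

  clauseSingleton-isHyp : ∀ j → IsHyp (clauseSingleton j)
  clauseSingleton-isHyp j =
      objectIntent-isIntent I₊ (gC j) (gC-intent? j)
    , λ i Cⱼ⊆hᵢ → Cⱼ⊆hᵢ (cl j) (Equivalence.from (∈-clauseSingleton j (cl j)) refl)

  minimal∉ℋ⇒clauseFree : ∀ {H} → (∀ H′ → IsHyp H′ → ¬ H′ ⊂ₛ H) → ¬ InCalH H →
                         ClauseFree H
  minimal∉ℋ⇒clauseFree {H} minimal H∉ℋ j Cⱼ∈H =
    minimal (clauseSingleton j) (clauseSingleton-isHyp j) (Cⱼ⊆H , H⊈Cⱼ)
    where
    Cⱼ⊆H : clauseSingleton j ⊆ₛ H
    Cⱼ⊆H m m∈ with refl ← Equivalence.to (∈-clauseSingleton j m) m∈ = Cⱼ∈H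
    H⊈Cⱼ : ¬ H ⊆ₛ clauseSingleton j
    H⊈Cⱼ H⊆Cⱼ = H∉ℋ (j , λ m → mk⇔
      (λ m∈H → Equivalence.to (∈-clauseSingleton j m) (H⊆Cⱼ m m∈H))
      (λ { refl → Cⱼ∈H }))

  module _ {H : Subset (Attr n k)} (hyp : IsHyp H) (free : ClauseFree H) where

    covers : ∀ i → Σ Bool λ b → lit (i , b) ∈ₛ H
    covers = clauseFreeHyp-coversVariable hyp free

    assignment : Fin n → Bool
    assignment i = not (proj₁ (covers i))

    falsified⇒∈H : ∀ l → assignment (proj₁ l) ≢ proj₂ l → lit l ∈ₛ H
    falsified⇒∈H (i , b) σᵢ≢b = subst (λ c → lit (i , c) ∈ₛ H) bᵢ≡b (proj₂ (covers i))
      where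
      bᵢ≡b : proj₁ (covers i) ≡ b
      bᵢ≡b = sym (trans (¬-not (σᵢ≢b ∘ sym)) (not-involutive _))

    gC∉extent : 1 ≤ n → ∀ j → ¬ extent H (gC j)
    gC∉extent 1≤n j gC∈ with (b , l∈H) ← covers (fromℕ< 1≤n) = gC∈ (lit (_ , b)) l∈H

    unsatisfied⇒∈H : 1 ≤ n → ∀ j → ¬ Any (λ l → assignment (proj₁ l) ≡ proj₂ l) (C j) →
                     cl j ∈ₛ H
    unsatisfied⇒∈H 1≤n j unsat = Equivalence.from (proj₁ hyp (cl j)) λ where
      (gl l)  gl∈ l∈Cⱼ → gl∈ (lit l) (falsified⇒∈H l λ true-l → unsat (lose l∈Cⱼ true-l)) refl
      (gC j′) gC∈      → ⊥-elim (gC∉extent 1≤n j′ gC∈)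

    clauseFreeHyp⇒satisfiable : 1 ≤ n → Satisfiable C
    clauseFreeHyp⇒satisfiable 1≤n = assignment , satisfied
      where
      satisfied : Satisfies assignment
      satisfied j with any? (λ l → assignment (proj₁ l) ≟ᵇ proj₂ l) (C j)
      ... | yes some = find some
      ... | no none  = ⊥-elim (free j (unsatisfied⇒∈H 1≤n j none))

  Falsified : (Fin n → Bool) → Attr n k → Set
  Falsified σ (cl _)        = ⊥
  Falsified σ (lit (i , b)) = b ≡ not (σ i)

  falsified? : ∀ σ → Decidable (Falsified σ)
  falsified? σ (cl _)        = no λ ()
  falsified? σ (lit (i , b)) = b ≟ᵇ not (σ i)

  falsifiedBy : (Fin n → Bool) → Subset (Attr n k)
  falsifiedBy σ = subsetOf (falsified? σ)

  module _ (σ : Fin n → Bool) where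

    private
      ∈F⇒ : ∀ m → m ∈ₛ falsifiedBy σ → Falsified σ m
      ∈F⇒ m = Equivalence.to (∈-subsetOf (falsified? σ))
      ⇒∈F : ∀ {m} → Falsified σ m → m ∈ₛ falsifiedBy σ
      ⇒∈F = Equivalence.from (∈-subsetOf (falsified? σ))

    falsifiedBy-clauseFree : ClauseFree (falsifiedBy σ)
    falsifiedBy-clauseFree j = ∈F⇒ (cl j)

    true⇒gl∈extent : ∀ l → σ (proj₁ l) ≡ proj₂ l → extent (falsifiedBy σ) (gl l)
    true⇒gl∈extent (i , b) σᵢ≡b (lit (.i , .b)) m∈ refl = not-¬ (sym σᵢ≡b) (∈F⇒ _ m∈)
    true⇒gl∈extent l σᵢ≡b (cl j) m∈ = ⊥-elim (∈F⇒ (cl j) m∈)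

    falsifiedBy-isHyp : Satisfies σ → IsHyp (falsifiedBy σ)
    falsifiedBy-isHyp sat = closed⇒isIntent I₊ closed , escapes
      where
      closed : ∀ m → intentOf (extent (falsifiedBy σ)) m → m ∈ₛ falsifiedBy σ
      closed (cl j) m∈B″ with (l , l∈Cⱼ , true-l) ← sat j =
        ⊥-elim (m∈B″ (gl l) (true⇒gl∈extent l true-l) l∈Cⱼ)
      closed (lit (i , b)) m∈B″ = ⇒∈F (¬-not λ b≡σᵢ →
        m∈B″ (gl (i , σ i)) (true⇒gl∈extent (i , σ i) refl) (cong (i ,_) b≡σᵢ))
      escapes : ∀ i → ¬ (∀ m → m ∈ₛ falsifiedBy σ → I₋ i m)
      escapes i F⊆hᵢ = F⊆hᵢ (lit (i , not (σ i))) (⇒∈F refl) refl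

    falsifiedBy-minimal : ∀ H′ → IsHyp H′ → ¬ H′ ⊂ₛ falsifiedBy σ
    falsifiedBy-minimal H′ hyp′ (H′⊆F , F⊈H′) = F⊈H′ F⊆H′
      where
      F⊆H′ : falsifiedBy σ ⊆ₛ H′
      F⊆H′ (cl j) m∈ = ⊥-elim (∈F⇒ (cl j) m∈)
      F⊆H′ (lit (i , b)) m∈
        with (c , c∈H′) ← clauseFreeHyp-coversVariable hyp′
                            (⊆-clauseFree H′⊆F falsifiedBy-clauseFree) i
        = subst (λ d → lit (i , d) ∈ₛ H′)
                (trans (∈F⇒ _ (H′⊆F _ c∈H′)) (sym (∈F⇒ _ m∈))) c∈H′

theorem1 : (n k : ℕ) → 1 ≤ n → (C : CNF n k) →
    (Σ (Subset (Attr n k)) (λ H →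
        Reduction.IsMinHyp C H × ¬ Reduction.InCalH C H))
    ⇔ Satisfiable C
theorem1 n k 1≤n C = mk⇔ forward backward
  where
  open Reduction C
  open ReductionProperties C

  forward : Σ (Subset (Attr n k)) (λ H → IsMinHyp H × ¬ InCalH H) → Satisfiable C
  forward (H , inj₁ (hyp , minimal) , H∉ℋ) =
    clauseFreeHyp⇒satisfiable hyp (minimal∉ℋ⇒clauseFree minimal H∉ℋ) 1≤n
  forward (_ , inj₂ (noHyp , _) , _) =
    (λ _ → true) , λ j → ⊥-elim (noHyp _ (clauseSingleton-isHyp j))

  backward : Satisfiable C → Σ (Subset (Attr n k)) (λ H → IsMinHyp H × ¬ InCalH H)
  backward (σ , sat) =
      falsifiedBy σ
    , inj₁ (falsifiedBy-isHyp σ sat , falsifiedBy-minimal σ)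
    , clauseFree⇒∉ℋ (falsifiedBy-clauseFree σ)
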